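{- Let $G$ be the grid defined in the context. For all integers $a,b\ge0$ there exist strings $w$ and $v$ over $\{0,1,2\}$ (possibly empty) such that $G(3a,2b)=\overline{w0}$, $G(3a,2b+1)=\overline{w1}$, $G(3a+1,2b)=\overline{w2}$ (these three positions form an "upperZ"), and $G(3a+1,2b+1)=\overline{v0}$, $G(3a+2,2b)=\overline{v1}$, $G(3a+2,2b+1)=\overline{v2}$ (these three positions form a "lowerZ"). In particular, the grid positions are partitioned into these triples (halfZs), each triple consisting of three strings that agree except in the last digit, with last digits $0,1,2$ in the listed order.
   Context: For a finite string $w=a_na_{n-1}\cdots a_0$ over digits $\{0,1,2\}$ let $[w]_{3/2}=\sum_k a_k(3/2)^k$. Define an operation $T$ on such strings ("adding 2 in base $\frac32$"): if $w$ contains no digit $0$, first replace $w$ by $0w$; then change the rightmost $0$ of $w$ into $2$, change every digit to the right of it by $1\mapsto0$, $2\mapsto1$, and leave all digits to the left of it unchanged. Then $[T(w)]_{3/2}=[w]_{3/2}+2$. The grid $G$ has entries $G(i,j)$ (row $i$, column $j$, $i,j\ge0$): $G(0,j)$ is the binary representation of $j$ (so row $0$ is $0,1,10,11,100,\dots$), and $G(i+1,j)=T(G(i,j))$. $\overline{XY}$ denotes concatenation of strings $X$ and $Y$. -}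

module Defs where

open import Data.Nat using (ℕ; zero; suc; _+_; _*_)
open import Data.Nat.DivMod using (_/_; _%_)
open import Data.List using (List; []; _∷_; _++_; reverse; [_])

data Digit : Set where
  d0 d1 d2 : Digit

-- A string a_n a_{n-1} ... a_0 is a list written most-significant digit first,
-- so the list head is a_n and the last element is a_0.
Str : Set
Str = List Digit

-- T on the reversed string (least significant digit first):
-- find the first 0 (= rightmost 0 of the written string), turn it into 2,
-- decrement all digits before it (1 ↦ 0, 2 ↦ 1); if there is no 0,
-- a leading 0 is prepended first (i.e. appended at the end of the reversed list).
Trev : List Digit → List Digit
Trev []        = d2 ∷ []
Trev (d0 ∷ ds) = d2 ∷ ds
Trev (d1 ∷ ds) = d0 ∷ Trev ds
Trev (d2 ∷ ds) = d1 ∷ Trev ds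

-- The operation T ("adding 2 in base 3/2") on written strings.
T : Str → Str
T w = reverse (Trev (reverse w))

-- Binary digits, least significant first, of m, computed with fuel;
-- fuel ≥ m suffices (each step halves m).
binRevFuel : ℕ → ℕ → List Digit
binRevFuel zero          m = []
binRevFuel (suc fuel) zero = []
binRevFuel (suc fuel) (suc m) = bit (suc m % 2) ∷ binRevFuel fuel (suc m / 2)
  where
  bit : ℕ → Digit
  bit zero = d0
  bit _    = d1

-- Binary representation of j, most significant digit first, no leading zeros;
-- 0 is represented by the one-digit string 0 (row 0 is 0, 1, 10, 11, 100, ...).
bin : ℕ → Str
bin zero    = d0 ∷ []
bin (suc j) = reverse (binRevFuel (suc j) (suc j))

G : ℕ → ℕ → Str
G zero    j = bin j
G (suc i) j = T (G i j)

module Submission where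

-- Proof idea.  Read every string backwards (least significant digit first);
-- then T becomes Trev, which only ever rewrites a prefix of the reversed list.
--
--  * Row 0: the binary expansions of 2b and 2b+1 reversed are 0x and 1x for
--    the common tail x = binRev b (the reversed binary expansion of b).
--  * Three steps of T fix the last digit and apply T twice to the rest:
--    Trev³ (d ∷ y) ≡ d ∷ Trev² y for every digit d.  Hence row 3a holds
--    0y and 1y in columns 2b, 2b+1, with y = Trev^(2a) x.
--  * One and two further steps give, in columns 2b and 2b+1,
--    row 3a+1: 2y, 0(Ty) and row 3a+2: 1(Ty), 2(Ty), which read forwards are
--    exactly the upper Z with w = reverse y and the lower Z with v = reverse (Ty).

open import Defs
open import Data.Nat using (ℕ; zero; suc; _+_; _*_; _≤_; z≤n; s≤s; s≤s⁻¹)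
open import Data.Nat.Properties using (*-comm; +-comm; *-suc; +-suc; +-identityʳ; ≤-trans; ≤-refl; m≤m*n)
open import Data.Nat.DivMod using (_/_; _%_; m*n%n≡0; m*n/n≡m; [m+kn]%n≡m%n; +-distrib-/-∣ʳ; m/n<m)
open import Data.Nat.Divisibility using (divides-refl)
open import Data.Nat.GeneralisedArithmetic using (fold)
open import Data.List using (List; []; _∷_; _++_; [_]; reverse)
open import Data.List.Properties using (reverse-involutive; unfold-reverse)
open import Data.Product using (Σ; _×_; _,_)
open import Relation.Binary.PropositionalEquality using (_≡_; refl; sym; trans; cong; module ≡-Reasoning)

binRev : ℕ → List Digit
binRev m = binRevFuel m m

-- The fuel only has to be large enough: any two sufficient fuels agree.
-- (The digit is computed by a helper local to binRevFuel from suc m % 2,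
-- so the recursive case has to inspect that remainder.)
binRevFuel-fuel : ∀ f g m → m ≤ f → m ≤ g → binRevFuel f m ≡ binRevFuel g m
binRevFuel-fuel zero    g       zero    _ _ = sym (empty g)
  where
  empty : ∀ g → binRevFuel g zero ≡ []
  empty zero    = refl
  empty (suc _) = refl
binRevFuel-fuel (suc f) zero    zero    _ _ = refl
binRevFuel-fuel (suc f) (suc g) zero    _ _ = refl
binRevFuel-fuel (suc f) (suc g) (suc m) (s≤s m≤f) (s≤s m≤g)
  with suc m % 2 | binRevFuel-fuel f g (suc m / 2) (≤-trans half≤m m≤f) (≤-trans half≤m m≤g)
  where
  half≤m : suc m / 2 ≤ m
  half≤m = s≤s⁻¹ (m/n<m (suc m) 2 (s≤s (s≤s z≤n)))
... | zero  | tails = cong (d0 ∷_) tails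
... | suc _ | tails = cong (d1 ∷_) tails

even-mod-2 : ∀ m → m * 2 % 2 ≡ 0
even-mod-2 m = m*n%n≡0 m 2

even-div-2 : ∀ m → m * 2 / 2 ≡ m
even-div-2 m = m*n/n≡m m 2

odd-mod-2 : ∀ m → (1 + m * 2) % 2 ≡ 1
odd-mod-2 m = [m+kn]%n≡m%n 1 m 2

odd-div-2 : ∀ m → (1 + m * 2) / 2 ≡ m
odd-div-2 m = trans (+-distrib-/-∣ʳ 1 {d = 2} (divides-refl m)) (even-div-2 m)

binRev-even : ∀ m → binRev (suc m * 2) ≡ d0 ∷ binRev (suc m)
binRev-even m rewrite even-mod-2 (suc m) | even-div-2 (suc m) =
  cong (d0 ∷_) (binRevFuel-fuel (suc (m * 2)) (suc m) (suc m) (s≤s (m≤m*n m 2)) ≤-refl)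

binRev-odd : ∀ m → binRev (1 + m * 2) ≡ d1 ∷ binRev m
binRev-odd m rewrite odd-mod-2 m | odd-div-2 m =
  cong (d1 ∷_) (binRevFuel-fuel (m * 2) m m (m≤m*n m 2) ≤-refl)

reverse-bin-suc : ∀ j → reverse (bin (suc j)) ≡ binRev (suc j)
reverse-bin-suc j = reverse-involutive (binRev (suc j))

row0-even : ∀ b → reverse (bin (2 * b)) ≡ d0 ∷ binRev b
row0-even b rewrite *-comm 2 b = even b
  where
  even : ∀ b → reverse (bin (b * 2)) ≡ d0 ∷ binRev b
  even zero    = refl
  even (suc b) = trans (reverse-bin-suc (suc (b * 2))) (binRev-even b)

row0-odd : ∀ b → reverse (bin (2 * b + 1)) ≡ d1 ∷ binRev b
row0-odd b rewrite +-comm (2 * b) 1 | *-comm 2 b =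
  trans (reverse-bin-suc (b * 2)) (binRev-odd b)

reverse-T : ∀ w → reverse (T w) ≡ Trev (reverse w)
reverse-T w = reverse-involutive (Trev (reverse w))

grid-shift : ∀ i k j → reverse (G (i + k) j) ≡ fold (reverse (G i j)) Trev k
grid-shift i zero    j rewrite +-identityʳ i = refl
grid-shift i (suc k) j rewrite +-suc i k =
  trans (reverse-T (G (i + k) j)) (cong Trev (grid-shift i k j))

-- Three steps of T fix the last digit and act as two steps of T on the rest
-- (in value: adding 6 to d + (3/2)·[y] adds 4 = 2 + 2 to [y]).
Trev³-cons : ∀ d y → Trev (Trev (Trev (d ∷ y))) ≡ d ∷ Trev (Trev y)
Trev³-cons d0 y = refl
Trev³-cons d1 y = refl
Trev³-cons d2 y = refl

fold-cycle : ∀ a d y → fold (d ∷ y) Trev (3 * a) ≡ d ∷ fold y Trev (2 * a)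
fold-cycle zero    d y = refl
fold-cycle (suc a) d y = begin
  fold (d ∷ y) Trev (3 * suc a)         ≡⟨ cong (fold (d ∷ y) Trev) (*-suc 3 a) ⟩
  Trev³ (fold (d ∷ y) Trev (3 * a))     ≡⟨ cong Trev³ (fold-cycle a d y) ⟩
  Trev³ (d ∷ fold y Trev (2 * a))       ≡⟨ Trev³-cons d (fold y Trev (2 * a)) ⟩
  d ∷ Trev (Trev (fold y Trev (2 * a))) ≡⟨ cong (λ n → d ∷ fold y Trev n) (sym (*-suc 2 a)) ⟩
  d ∷ fold y Trev (2 * suc a)           ∎
  where
  open ≡-Reasoning
  Trev³ : List Digit → List Digit
  Trev³ r = Trev (Trev (Trev r))

row-3a : ∀ a j d x → reverse (bin j) ≡ d ∷ x →
         reverse (G (3 * a) j) ≡ d ∷ fold x Trev (2 * a)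
row-3a a j d x row0 = begin
  reverse (G (3 * a) j)               ≡⟨ grid-shift 0 (3 * a) j ⟩
  fold (reverse (bin j)) Trev (3 * a) ≡⟨ cong (λ r → fold r Trev (3 * a)) row0 ⟩
  fold (d ∷ x) Trev (3 * a)           ≡⟨ fold-cycle a d x ⟩
  d ∷ fold x Trev (2 * a)             ∎
  where open ≡-Reasoning

from-reverse : ∀ {s : Str} {d x} → reverse s ≡ d ∷ x → s ≡ reverse x ++ [ d ]
from-reverse {s} {d} {x} e =
  trans (sym (reverse-involutive s)) (trans (cong reverse e) (unfold-reverse d x))

lemma4 : (a b : ℕ) →
    Σ Str (λ w → Σ Str (λ v →
      (G (3 * a) (2 * b) ≡ w ++ [ d0 ] ×
       G (3 * a) (2 * b + 1) ≡ w ++ [ d1 ] ×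
       G (3 * a + 1) (2 * b) ≡ w ++ [ d2 ]) ×
      (G (3 * a + 1) (2 * b + 1) ≡ v ++ [ d0 ] ×
       G (3 * a + 2) (2 * b) ≡ v ++ [ d1 ] ×
       G (3 * a + 2) (2 * b + 1) ≡ v ++ [ d2 ])))
lemma4 a b = reverse y , reverse (Trev y) ,
  (from-reverse top₀ , from-reverse top₁ , from-reverse (below 1 top₀)) ,
  (from-reverse (below 1 top₁) , from-reverse (below 2 top₀) , from-reverse (below 2 top₁))
  where
  y : List Digit
  y = fold (binRev b) Trev (2 * a)

  top₀ : reverse (G (3 * a) (2 * b)) ≡ d0 ∷ y
  top₀ = row-3a a (2 * b) d0 (binRev b) (row0-even b)

  top₁ : reverse (G (3 * a) (2 * b + 1)) ≡ d1 ∷ y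
  top₁ = row-3a a (2 * b + 1) d1 (binRev b) (row0-odd b)

  -- Rows 3a+1 and 3a+2: Trev (0y) = 2y, Trev (1y) = 0(Ty),
  -- Trev² (0y) = 1(Ty), Trev² (1y) = 2(Ty).
  below : ∀ k {j d} → reverse (G (3 * a) j) ≡ d ∷ y →
          reverse (G (3 * a + k) j) ≡ fold (d ∷ y) Trev k
  below k {j} e = trans (grid-shift (3 * a) k j) (cong (λ r → fold r Trev k) e)
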